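{- Let $B$ be a positive zero forcing set of a graph $G$, and let $C_1,\dots,C_k$ be the connected components of $G-B$. Then for each $i\in\{1,\dots,k\}$ there is a vertex of $C_i$ which is the only neighbour in $C_i$ of at least one vertex of $B$. Moreover, if $v\in C_i$ is the only neighbour in $C_i$ of a vertex $u\in B$, then $(B\setminus\{u\})\cup\{v\}$ is a positive zero forcing set of $G$.
   Context: All graphs are finite, simple and undirected. Positive semidefinite colour change rule: vertices are coloured black or white; let $B'$ be the set of black vertices and $W_1,\dots,W_r$ the vertex sets of the connected components of $G-B'$; if $u\in B'$ and $w\in W_i$ is the only white neighbour of $u$ in the subgraph induced by $B'\cup W_i$, then $w$ is recoloured black. A set $S\subseteq V(G)$ is a positive zero forcing set if, starting with $S$ black and all other vertices white, repeated application of this rule colours all vertices black. -}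

module Defs where

open import Data.Nat using (ℕ)
open import Data.Bool using (Bool; true; false)
open import Data.Fin using (Fin)
open import Data.Fin.Subset using (Subset; _∈_; _∉_; _∪_; ⁅_⁆; ⊤)
open import Relation.Binary.PropositionalEquality using (_≡_)

record Graph (n : ℕ) : Set where
  field
    adj     : Fin n → Fin n → Bool
    adj-sym : ∀ x y → adj x y ≡ adj y x
    irrefl  : ∀ x → adj x x ≡ false

open Graph public

Adj : ∀ {n} → Graph n → Fin n → Fin n → Set
Adj G x y = adj G x y ≡ true

-- WConn G B x y : x and y lie in the same connected component of G - B
-- (there is a walk from x to y using only vertices outside B).
data WConn {n : ℕ} (G : Graph n) (B : Subset n) : Fin n → Fin n → Set where
  here : ∀ {x} → x ∉ B → WConn G B x x
  next : ∀ {x y z} → WConn G B x y → Adj G y z → z ∉ B → WConn G B x z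

-- PSD colour change rule: with black set B, the black vertex u forces the
-- white vertex w, where W is the component of G - B containing w, if w is
-- the only white neighbour of u in G[B ∪ W].
record Forces {n : ℕ} (G : Graph n) (B : Subset n) (u w : Fin n) : Set where
  field
    u-black : u ∈ B
    w-white : w ∉ B
    uw-adj  : Adj G u w
    unique  : ∀ w' → WConn G B w w' → Adj G u w' → w' ≡ w

data ForcesAll {n : ℕ} (G : Graph n) : Subset n → Set where
  done  : ∀ {B} → (∀ x → x ∈ B) → ForcesAll G B
  force : ∀ {B} (u w : Fin n) → Forces G B u w →
          ForcesAll G (B ∪ ⁅ w ⁆) → ForcesAll G B

PositiveZeroForcingSet : ∀ {n} → Graph n → Subset n → Set
PositiveZeroForcingSet G S = ForcesAll G S

module Submission where

-- Part 1 follows a forcing process from B: C stays white until one of its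
-- vertices v is forced, and the forcing vertex u of the first such force
-- lies in B and has v as its only neighbour in C.  For part 2, from the
-- swapped set v forces u at once, because the white component of u then
-- misses C; afterwards every vertex of B is black, so monotonicity finishes.

open import Defs
open import Data.Nat using (ℕ)
open import Data.Bool using (true)
import Data.Bool as Bool
open import Data.Fin using (Fin; zero; suc; _≟_)
open import Data.Fin.Properties using (any?)
open import Data.Fin.Subset
  using (Subset; _∈_; _∉_; _∪_; _-_; ⁅_⁆; _⊆_; _⊂_; _⊃_)
open import Data.Fin.Subset.Properties
  using (_∈?_; x∈p∪q⁻; x∈p∪q⁺; p⊆p∪q; x∈⁅x⁆; x∈⁅y⁆⇒x≡y; x∈p∧x≢y⇒x∈p-y)
open import Data.Fin.Subset.Induction using (Acc; acc; ⊃-wellFounded)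
open import Data.Vec.Base using (_∷_; there)
open import Data.Product using (Σ; _×_; ∃; _,_)
open import Data.Sum using (inj₁; inj₂; _⊎_)
open import Data.Empty using (⊥-elim)
open import Function using (_∘_)
open import Relation.Nullary using (Dec; yes; no; ¬_)
open import Relation.Nullary.Decidable using (_×-dec_; map′)
open import Relation.Binary.PropositionalEquality using (_≡_; _≢_; refl; sym; trans; subst)

∪⁅⁆-least : ∀ {n} {S T : Subset n} {w : Fin n} → S ⊆ T → w ∈ T → S ∪ ⁅ w ⁆ ⊆ T
∪⁅⁆-least {S = S} {w = w} S⊆T w∈T x∈ with x∈p∪q⁻ S ⁅ w ⁆ x∈
... | inj₁ x∈S = S⊆T x∈S
... | inj₂ x∈w = subst (_∈ _) (sym (x∈⁅y⁆⇒x≡y w x∈w)) w∈T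

∈∪⁅⁆ : ∀ {n} {S : Subset n} (w : Fin n) → w ∈ S ∪ ⁅ w ⁆
∈∪⁅⁆ w = x∈p∪q⁺ (inj₂ (x∈⁅x⁆ w))

∉∪⁅⁆ : ∀ {n} {S : Subset n} {x w : Fin n} → x ∉ S → x ≢ w → x ∉ S ∪ ⁅ w ⁆
∉∪⁅⁆ {S = S} {w = w} x∉S x≢w x∈ with x∈p∪q⁻ S ⁅ w ⁆ x∈
... | inj₁ x∈S = x∉S x∈S
... | inj₂ x∈w = x≢w (x∈⁅y⁆⇒x≡y w x∈w)

⊂∪⁅⁆ : ∀ {n} {S : Subset n} {w : Fin n} → w ∉ S → S ⊂ S ∪ ⁅ w ⁆
⊂∪⁅⁆ {w = w} w∉S = p⊆p∪q _ , w , ∈∪⁅⁆ w , w∉S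

∉-self : ∀ {n} (S : Subset n) (x : Fin n) → x ∉ S - x
∉-self (_ ∷ S) zero ()
∉-self (_ ∷ S) (suc x) (there x∈) = ∉-self S x x∈

module _ {n : ℕ} (G : Graph n) where

  adj-symm : ∀ {x y} → Adj G x y → Adj G y x
  adj-symm {x} {y} = trans (adj-sym G y x)

  adj? : ∀ x y → Dec (Adj G x y)
  adj? x y = adj G x y Bool.≟ true

  walk-start-white : ∀ {B x y} → WConn G B x y → x ∉ B
  walk-start-white (here x∉B)  = x∉B
  walk-start-white (next p _ _) = walk-start-white p

  walk-end-white : ∀ {B x y} → WConn G B x y → y ∉ B
  walk-end-white (here y∉B)     = y∉B
  walk-end-white (next _ _ y∉B) = y∉B

  walk-trans : ∀ {B x y z} → WConn G B x y → WConn G B y z → WConn G B x z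
  walk-trans p (here _)        = p
  walk-trans p (next q yz z∉B) = next (walk-trans p q) yz z∉B

  walk-sym : ∀ {B x y} → WConn G B x y → WConn G B y x
  walk-sym (here x∉B)           = here x∉B
  walk-sym (next p yz z∉B) =
    walk-trans (next (here z∉B) (adj-symm yz) (walk-end-white p)) (walk-sym p)

  walk-⊆ : ∀ {B T x y} → B ⊆ T → WConn G T x y → WConn G B x y
  walk-⊆ B⊆T (here x∉T)     = here (x∉T ∘ B⊆T)
  walk-⊆ B⊆T (next p yz z∉T) = next (walk-⊆ B⊆T p) yz (z∉T ∘ B⊆T)

  walk-lift : ∀ {B B' c x} → (∀ y → WConn G B c y → y ∉ B') →
              WConn G B c x → WConn G B' c x
  walk-lift {x = x} C∩B'=∅ p@(here _)     = here (C∩B'=∅ x p)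
  walk-lift {x = x} C∩B'=∅ p@(next q yz _) =
    next (walk-lift C∩B'=∅ q) yz (C∩B'=∅ x p)

  -- A nontrivial walk from c first steps to a neighbour z of c, from which
  -- a walk avoiding c reaches the end (cut at the last visit of c).
  walk-first-step : ∀ {B c y} → WConn G B c y →
                    c ≡ y ⊎ ∃ λ z → Adj G c z × WConn G (B ∪ ⁅ c ⁆) z y
  walk-first-step (here _) = inj₁ refl
  walk-first-step {c = c} (next {z = z} p yz z∉B) with z ≟ c
  ... | yes z≡c = inj₁ (sym z≡c)
  ... | no z≢c with walk-first-step p
  ...   | inj₁ refl                = inj₂ (z , yz , here (∉∪⁅⁆ z∉B z≢c))
  ...   | inj₂ (z₀ , cz₀ , z₀→y) = inj₂ (z₀ , cz₀ , next z₀→y yz (∉∪⁅⁆ z∉B z≢c))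

  walk-from-step : ∀ {B c y} → c ∉ B →
                   (∃ λ z → Adj G c z × WConn G (B ∪ ⁅ c ⁆) z y) → WConn G B c y
  walk-from-step c∉B (z , cz , z→y) =
    walk-trans (next (here c∉B) cz (walk-start-white z→y ∘ p⊆p∪q _))
               (walk-⊆ (p⊆p∪q _) z→y)

  -- Reachability in G - B is decidable.  Recursing through the first step
  -- blackens c, so the recursion is well founded on black sets under ⊃.
  walk-dec-acc : ∀ B → Acc _⊃_ B → ∀ c y → Dec (WConn G B c y)
  walk-dec-acc B _ c y with c ∈? B
  ... | yes c∈B = no λ p → walk-start-white p c∈B
  ... | no c∉B with c ≟ y
  ...   | yes refl = yes (here c∉B)
  walk-dec-acc B (acc larger) c y | no c∉B | no c≢y =
    map′ (walk-from-step c∉B) from-walk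
      (any? λ z → adj? c z ×-dec walk-dec-acc (B ∪ ⁅ c ⁆) (larger (⊂∪⁅⁆ c∉B)) z y)
    where
    from-walk : WConn G B c y → ∃ λ z → Adj G c z × WConn G (B ∪ ⁅ c ⁆) z y
    from-walk p with walk-first-step p
    ... | inj₁ c≡y = ⊥-elim (c≢y c≡y)
    ... | inj₂ step = step

  walk-dec : ∀ B c y → Dec (WConn G B c y)
  walk-dec B = walk-dec-acc B (⊃-wellFounded B)

  -- A force from S remains a force from any T ⊇ S with the target still
  -- white: components of G - T lie inside components of G - S.
  forces-⊆ : ∀ {S T u w} → S ⊆ T → w ∉ T → Forces G S u w → Forces G T u w
  forces-⊆ S⊆T w∉T f = record
    { u-black = S⊆T (Forces.u-black f)
    ; w-white = w∉T
    ; uw-adj  = Forces.uw-adj f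
    ; unique  = λ w' p → Forces.unique f w' (walk-⊆ S⊆T p)
    }

  -- Every superset of a positive zero forcing set is one: replay the same
  -- forces, skipping those whose target is already black.
  forcesAll-⊆ : ∀ {S T} → ForcesAll G S → S ⊆ T → ForcesAll G T
  forcesAll-⊆ (done all) S⊆T = done (S⊆T ∘ all)
  forcesAll-⊆ {T = T} (force u w f rest) S⊆T with w ∈? T
  ... | yes w∈T = forcesAll-⊆ rest (∪⁅⁆-least S⊆T w∈T)
  ... | no w∉T  = force u w (forces-⊆ S⊆T w∉T f)
                    (forcesAll-⊆ rest (∪⁅⁆-least (p⊆p∪q _ ∘ S⊆T) (∈∪⁅⁆ w)))

  -- Part 1, as an invariant of a forcing process currently at black set
  -- B' ⊇ B with the component C of c in G - B still white.  Some later force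
  -- u → v is the first to hit C; then u ∈ B (a neighbour of C outside B
  -- would belong to C), and C lies in the white component of v, so v is the
  -- only neighbour of u in C.
  first-force-into-component : ∀ {B B'} (c : Fin n) → ForcesAll G B' → B ⊆ B' →
    (∀ y → WConn G B c y → y ∉ B') → c ∉ B →
    Σ (Fin n) λ v → Σ (Fin n) λ u →
      WConn G B c v × u ∈ B × Adj G u v × (∀ w → WConn G B c w → Adj G u w → w ≡ v)
  first-force-into-component c (done all) _ C-white c∉B =
    ⊥-elim (C-white c (here c∉B) (all c))
  first-force-into-component {B} {B'} c (force u v f rest) B⊆B' C-white c∉B
    with walk-dec B c v
  ... | yes c→v = v , u , c→v , u∈B , Forces.uw-adj f , only-neighbour
    where
    u∈B : u ∈ B
    u∈B with u ∈? B
    ... | yes u∈B = u∈B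
    ... | no u∉B  = ⊥-elim (C-white u (next c→v (adj-symm (Forces.uw-adj f)) u∉B)
                                      (Forces.u-black f))
    only-neighbour : ∀ w → WConn G B c w → Adj G u w → w ≡ v
    only-neighbour w c→w =
      Forces.unique f w (walk-trans (walk-sym (walk-lift C-white c→v))
                                    (walk-lift C-white c→w))
  ... | no ¬c→v = first-force-into-component c rest (p⊆p∪q _ ∘ B⊆B') C-still-white c∉B
    where
    C-still-white : ∀ y → WConn G B c y → y ∉ B' ∪ ⁅ v ⁆
    C-still-white y c→y = ∉∪⁅⁆ (C-white y c→y) λ { refl → ¬c→v c→y }

  swap-unique-neighbour : ∀ B → ForcesAll G B → (c u v : Fin n) → c ∉ B → u ∈ B →
    WConn G B c v → Adj G u v → (∀ w → WConn G B c w → Adj G u w → w ≡ v) →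
    ForcesAll G ((B - u) ∪ ⁅ v ⁆)
  swap-unique-neighbour B B-forces c u v _ u∈B c→v uv only-v =
    force v u v-forces-u (forcesAll-⊆ B-forces B⊆B'∪u)
    where
    B' : Subset n
    B' = (B - u) ∪ ⁅ v ⁆

    kept : ∀ {x} → x ∈ B → x ≢ u → x ∈ B'
    kept x∈B x≢u = x∈p∪q⁺ (inj₁ (x∈p∧x≢y⇒x∈p-y x∈B x≢u))

    B⊆B'∪u : B ⊆ B' ∪ ⁅ u ⁆
    B⊆B'∪u {x} x∈B with x ≟ u
    ... | yes refl = ∈∪⁅⁆ x
    ... | no x≢u   = p⊆p∪q _ (kept x∈B x≢u)

    u∉B' : u ∉ B'
    u∉B' = ∉∪⁅⁆ (∉-self B u) λ { refl → walk-end-white c→v u∈B }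

    -- The white component of u in G - B' is disjoint from C: the only
    -- way out of u into C is through v, which is now black.
    avoids-C : ∀ {x} → WConn G B' u x → ¬ WConn G B c x
    avoids-C (here _) c→u = walk-end-white c→u u∈B
    avoids-C (next {y = y} {z = z} p yz z∉B') c→z with y ∈? B
    ... | no y∉B = avoids-C p (next c→z (adj-symm yz) y∉B)
    ... | yes y∈B with y ≟ u
    ...   | no y≢u  = walk-end-white p (kept y∈B y≢u)
    ...   | yes refl = z∉B' (subst (_∈ B') (sym (only-v z c→z yz)) (∈∪⁅⁆ v))

    v-only-white-neighbour : ∀ w → WConn G B' u w → Adj G v w → w ≡ u
    v-only-white-neighbour w u→w vw with w ≟ u
    ... | yes w≡u = w≡u
    ... | no w≢u with w ∈? B
    ...   | yes w∈B = ⊥-elim (walk-end-white u→w (kept w∈B w≢u))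
    ...   | no w∉B  = ⊥-elim (avoids-C u→w (next c→v vw w∉B))

    v-forces-u : Forces G B' v u
    v-forces-u = record
      { u-black = ∈∪⁅⁆ v
      ; w-white = u∉B'
      ; uw-adj  = adj-symm uv
      ; unique  = v-only-white-neighbour
      }

lemma6p5 : ∀ {n} (G : Graph n) (B : Subset n) → PositiveZeroForcingSet G B →
    ((c : Fin n) → c ∉ B →
      Σ (Fin n) λ v → Σ (Fin n) λ u →
        WConn G B c v × u ∈ B × Adj G u v ×
        (∀ w → WConn G B c w → Adj G u w → w ≡ v))
    ×
    ((c u v : Fin n) → c ∉ B → u ∈ B → WConn G B c v → Adj G u v →
      (∀ w → WConn G B c w → Adj G u w → w ≡ v) →
      PositiveZeroForcingSet G ((B - u) ∪ ⁅ v ⁆))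
lemma6p5 G B B-forces =
  (λ c c∉B → first-force-into-component G c B-forces (λ x∈B → x∈B)
                                        (λ y c→y → walk-end-white G c→y) c∉B)
  , swap-unique-neighbour G B B-forces
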